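{- Let $A$ be a set of $5$ distinct elements of $\mathbb{Z}_3^3$. Then either $A$ contains a nonempty subset of at most $3$ elements with sum $0$, or there are $3$ elements $x,y,z$ of $A$ with $x+y=z$. -}

module Defs where

open import Data.Nat using (ℕ; zero; suc)
import Data.Nat as N
open import Data.Nat.DivMod using (_mod_)
open import Data.Fin using (Fin; zero; suc; toℕ)
import Data.Fin as F
open import Data.Fin.Subset using (Subset; inside; outside)
open import Data.Vec using (Vec; []; _∷_; lookup; replicate; zipWith)
open import Data.Bool using (true; false)

-- ℤ₃ as Fin 3 with addition modulo 3 (Data.Fin._+_ is not modular).
_+₃_ : Fin 3 → Fin 3 → Fin 3
a +₃ b = (toℕ a N.+ toℕ b) mod 3

V : Set
V = Vec (Fin 3) 3

0V : V
0V = replicate 3 zero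

_+V_ : V → V → V
_+V_ = zipWith _+₃_

subsetSum : ∀ {n} → (Fin n → V) → Subset n → V
subsetSum {zero} A [] = 0V
subsetSum {suc n} A (inside ∷ S) = A zero +V subsetSum (λ i → A (suc i)) S
subsetSum {suc n} A (outside ∷ S) = subsetSum (λ i → A (suc i)) S

module Submission where

-- Over ℤ₃ the nonzero scalars are ±1, so both conclusions say that at most three
-- of the five vectors satisfy a linear relation with nonzero coefficients; the
-- one such relation not covered by them, x = y, is excluded by distinctness.
-- Identifying x with -x, the claim is that the projective plane PG(2,3) has no
-- five points with no three collinear (an arc in PG(2,q), q odd, has at most
-- q + 1 = 4 points). This is checked by an exhaustive search over five-tuples of
-- normalised representatives, pruned as soon as a relation appears.

open import Defs renaming (_+V_ to infixr 6 _+V_)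
open import Algebra.Bundles using (Group; AbelianGroup)
open import Algebra.Definitions using (Associative; Commutative; LeftIdentity; RightIdentity; LeftInverse; RightInverse)
open import Algebra.Structures using (IsAbelianGroup)
import Algebra.Properties.Group as GroupProperties
import Algebra.Properties.AbelianGroup as AbelianGroupProperties
import Algebra.Properties.CommutativeSemigroup as CommutativeSemigroupProperties
import Relation.Binary.Reasoning.Setoid as SetoidReasoning
open import Data.Bool using (Bool; false; T; _∨_)
open import Data.Bool.ListAction using (all)
open import Data.Bool.Properties using (T-∨)
open import Data.Empty using (⊥-elim)
open import Data.Fin using (Fin; zero; suc; _≟_; _<_; _<?_)
open import Data.Fin.Patterns using (0F; 1F; 2F; 3F; 4F)
open import Data.Fin.Properties using (all?; any?; <⇒≢; suc-injective)
open import Data.Fin.Subset using (inside; outside; ⊥; ⁅_⁆; _∪_; _∉_; ∣_∣)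
open import Data.Fin.Subset.Properties using (∪-identityˡ; ∣⁅x⁆∣≡1; x≢y⇒x∉⁅y⁆; x∈p∪q⁻; drop-not-there)
open import Data.List using (List; []; _∷_)
open import Data.List.Membership.Propositional using (_∈_)
open import Data.List.Membership.DecPropositional using (_∈?_)
open import Data.List.Relation.Unary.All using () renaming (lookup to All-lookup)
open import Data.List.Relation.Unary.All.Properties using (all⁺)
open import Data.Nat using (ℕ; zero; suc; _≤_; z≤n; s≤s)
open import Data.Product using (_×_; _,_; ∃; ∃-syntax)
open import Data.Sign using (Sign; +; -; _*_)
open import Data.Sign.Properties using (s*s≡+)
open import Data.Sum using (_⊎_; inj₁; inj₂; [_,_])
open import Data.Vec using (Vec; []; _∷_; lookup; map; tabulate; here)
open import Data.Vec.Properties using (≡-dec; zipWith-assoc; zipWith-comm; zipWith-identityˡ; zipWith-identityʳ; zipWith-inverseˡ; zipWith-inverseʳ; lookup∘tabulate)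
open import Function using (_∘_)
open import Function.Bundles using (Equivalence)
open import Function.Definitions using (Injective)
open import Level using (Level; 0ℓ)
open import Relation.Binary.PropositionalEquality using (_≡_; _≢_; _≗_; refl; sym; trans; cong; cong₂; subst₂; isEquivalence; ≢-sym; module ≡-Reasoning)
open import Relation.Nullary using (Dec)
open import Relation.Nullary.Decidable using (from-yes; isYes; toWitness; map′; _×-dec_; _⊎-dec_)
open import Relation.Unary using (Decidable)

module _ {a ℓ : Level} (G : Group a ℓ) where

  open Group G using (_≈_; _∙_; _⁻¹; ε; assoc; setoid)
  open GroupProperties G using (x∙y⁻¹≈ε⇒x≈y)
  open SetoidReasoning setoid

  x∙[y∙z⁻¹]≈ε⇒x∙y≈z : ∀ {x y z} → x ∙ (y ∙ z ⁻¹) ≈ ε → x ∙ y ≈ z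
  x∙[y∙z⁻¹]≈ε⇒x∙y≈z {x} {y} {z} eq = x∙y⁻¹≈ε⇒x≈y (x ∙ y) z (begin
    x ∙ y ∙ z ⁻¹     ≈⟨ assoc x y (z ⁻¹) ⟩
    x ∙ (y ∙ z ⁻¹)   ≈⟨ eq ⟩
    ε                ∎)

module _ {a ℓ : Level} (G : AbelianGroup a ℓ) where

  open AbelianGroup G using (_≈_; _∙_; _⁻¹; ε; comm; ∙-congˡ; group; setoid) renaming (sym to ≈-sym)
  open AbelianGroupProperties G using (x∙y⁻¹≈ε⇒x≈y; ⁻¹-∙-comm)
  open SetoidReasoning setoid

  x∙[y⁻¹∙z]≈ε⇒x∙z≈y : ∀ {x y z} → x ∙ (y ⁻¹ ∙ z) ≈ ε → x ∙ z ≈ y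
  x∙[y⁻¹∙z]≈ε⇒x∙z≈y {x} {y} {z} eq = x∙[y∙z⁻¹]≈ε⇒x∙y≈z group (begin
    x ∙ (z ∙ y ⁻¹)   ≈⟨ ∙-congˡ (comm z (y ⁻¹)) ⟩
    x ∙ (y ⁻¹ ∙ z)   ≈⟨ eq ⟩
    ε                ∎)

  x∙[y⁻¹∙z⁻¹]≈ε⇒y∙z≈x : ∀ {x y z} → x ∙ (y ⁻¹ ∙ z ⁻¹) ≈ ε → y ∙ z ≈ x
  x∙[y⁻¹∙z⁻¹]≈ε⇒y∙z≈x {x} {y} {z} eq = ≈-sym (x∙y⁻¹≈ε⇒x≈y x (y ∙ z) (begin
    x ∙ (y ∙ z) ⁻¹      ≈⟨ ∙-congˡ (⁻¹-∙-comm y z) ⟨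
    x ∙ (y ⁻¹ ∙ z ⁻¹)   ≈⟨ eq ⟩
    ε                   ∎))

neg₃ : Fin 3 → Fin 3
neg₃ 0F = 0F
neg₃ 1F = 2F
neg₃ 2F = 1F

infix 8 -V_
-V_ : V → V
-V_ = map neg₃

+₃-assoc : Associative _≡_ _+₃_
+₃-assoc = from-yes (all? λ a → all? λ b → all? λ c → (a +₃ b) +₃ c ≟ a +₃ (b +₃ c))

+₃-comm : Commutative _≡_ _+₃_
+₃-comm = from-yes (all? λ a → all? λ b → a +₃ b ≟ b +₃ a)

+₃-identityˡ : LeftIdentity _≡_ 0F _+₃_
+₃-identityˡ = from-yes (all? λ a → 0F +₃ a ≟ a)

+₃-identityʳ : RightIdentity _≡_ 0F _+₃_
+₃-identityʳ = from-yes (all? λ a → a +₃ 0F ≟ a)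

+₃-inverseˡ : LeftInverse _≡_ 0F neg₃ _+₃_
+₃-inverseˡ = from-yes (all? λ a → neg₃ a +₃ a ≟ 0F)

+₃-inverseʳ : RightInverse _≡_ 0F neg₃ _+₃_
+₃-inverseʳ = from-yes (all? λ a → a +₃ neg₃ a ≟ 0F)

+V-isAbelianGroup : IsAbelianGroup _≡_ _+V_ 0V -V_
+V-isAbelianGroup = record
  { isGroup = record
    { isMonoid = record
      { isSemigroup = record
        { isMagma = record { isEquivalence = isEquivalence ; ∙-cong = cong₂ _+V_ }
        ; assoc = zipWith-assoc +₃-assoc
        }
      ; identity = zipWith-identityˡ +₃-identityˡ , zipWith-identityʳ +₃-identityʳ
      }
    ; inverse = zipWith-inverseˡ +₃-inverseˡ , zipWith-inverseʳ +₃-inverseʳ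
    ; ⁻¹-cong = cong -V_
    }
  ; comm = zipWith-comm +₃-comm
  }

+V-abelianGroup : AbelianGroup 0ℓ 0ℓ
+V-abelianGroup = record { isAbelianGroup = +V-isAbelianGroup }

open AbelianGroup +V-abelianGroup using (identityʳ; commutativeSemigroup) renaming (group to +V-group)
open AbelianGroupProperties +V-abelianGroup using (⁻¹-involutive; ⁻¹-∙-comm; ε⁻¹≈ε; x∙y⁻¹≈ε⇒x≈y)
open CommutativeSemigroupProperties commutativeSemigroup using (x∙yz≈y∙xz)

infixr 7 _·_
_·_ : Sign → V → V
+ · x = x
- · x = -V x

·-assoc : ∀ s t x → s · (t · x) ≡ (s * t) · x
·-assoc + t x = refl
·-assoc - + x = refl
·-assoc - - x = ⁻¹-involutive x

·-assoc₃ : ∀ r s t x → (r * (s * t)) · x ≡ r · s · t · x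
·-assoc₃ r s t x = trans (sym (·-assoc r (s * t) x)) (cong (r ·_) (sym (·-assoc s t x)))

·-involutive : ∀ s x → s · (s · x) ≡ x
·-involutive s x = trans (·-assoc s s x) (cong (_· x) (s*s≡+ s))

·-distrib-+V : ∀ s x y → s · (x +V y) ≡ s · x +V s · y
·-distrib-+V + x y = refl
·-distrib-+V - x y = sym (⁻¹-∙-comm x y)

·-0V : ∀ s → s · 0V ≡ 0V
·-0V + = refl
·-0V - = ε⁻¹≈ε

·-rescale : ∀ s {x y} → s · x +V y ≡ 0V → x +V s · y ≡ 0V
·-rescale s {x} {y} eq = begin
  x +V s · y              ≡⟨ cong (_+V s · y) (sym (·-involutive s x)) ⟩
  s · (s · x) +V s · y    ≡⟨ sym (·-distrib-+V s (s · x) y) ⟩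
  s · (s · x +V y)        ≡⟨ cong (s ·_) eq ⟩
  s · 0V                  ≡⟨ ·-0V s ⟩
  0V                      ∎
  where open ≡-Reasoning

-- A linear relation with nonzero coefficients (over ℤ₃ these are ±1) among at
-- most three distinct members of f, the first coefficient scaled to 1.
data Dependency {n : ℕ} (f : Fin n → V) : Set where
  null   : ∀ i → f i ≡ 0V → Dependency f
  pair   : ∀ {i j} t → i ≢ j → f i +V t · f j ≡ 0V → Dependency f
  triple : ∀ {i j k} t u → i ≢ j → i ≢ k → j ≢ k →
           f i +V (t · f j +V u · f k) ≡ 0V → Dependency f

Dependency-subfamily : ∀ {m n} {f : Fin n → V} {g : Fin m → Fin n} →
                       Injective _≡_ _≡_ g → Dependency (f ∘ g) → Dependency f
Dependency-subfamily g-inj (null i eq) = null _ eq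
Dependency-subfamily g-inj (pair t i≢j eq) = pair t (i≢j ∘ g-inj) eq
Dependency-subfamily g-inj (triple t u i≢j i≢k j≢k eq) =
  triple t u (i≢j ∘ g-inj) (i≢k ∘ g-inj) (j≢k ∘ g-inj) eq

Dependency-≗ : ∀ {n} {f g : Fin n → V} → f ≗ g → Dependency f → Dependency g
Dependency-≗ f≗g (null i eq) = null i (trans (sym (f≗g i)) eq)
Dependency-≗ f≗g (pair {i} {j} t i≢j eq) =
  pair t i≢j (subst₂ (λ a b → a +V t · b ≡ 0V) (f≗g i) (f≗g j) eq)
Dependency-≗ f≗g (triple {i} {j} {k} t u i≢j i≢k j≢k eq) =
  triple t u i≢j i≢k j≢k (subst₂ (λ a b → a +V b ≡ 0V) (f≗g i) (cong₂ (λ b c → t · b +V u · c) (f≗g j) (f≗g k)) eq)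

Dependency-unsign : ∀ {n} {f : Fin n → V} (s : Fin n → Sign) → Dependency (λ i → s i · f i) → Dependency f
Dependency-unsign {f = f} s (null i eq) = null i (begin
  f i                 ≡⟨ ·-involutive (s i) (f i) ⟨
  s i · (s i · f i)   ≡⟨ cong (s i ·_) eq ⟩
  s i · 0V            ≡⟨ ·-0V (s i) ⟩
  0V                  ∎)
  where open ≡-Reasoning
Dependency-unsign {f = f} s (pair {i} {j} t i≢j eq) = pair (s i * (t * s j)) i≢j (begin
  f i +V (s i * (t * s j)) · f j   ≡⟨ cong (f i +V_) (·-assoc₃ (s i) t (s j) (f j)) ⟩
  f i +V s i · t · s j · f j       ≡⟨ ·-rescale (s i) eq ⟩
  0V                               ∎)
  where open ≡-Reasoning
Dependency-unsign {f = f} s (triple {i} {j} {k} t u i≢j i≢k j≢k eq) =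
  triple (s i * (t * s j)) (s i * (u * s k)) i≢j i≢k j≢k (begin
    f i +V ((s i * (t * s j)) · f j +V (s i * (u * s k)) · f k)
      ≡⟨ cong (f i +V_) (cong₂ _+V_ (·-assoc₃ (s i) t (s j) (f j)) (·-assoc₃ (s i) u (s k) (f k))) ⟩
    f i +V (s i · t · s j · f j +V s i · u · s k · f k)
      ≡⟨ cong (f i +V_) (·-distrib-+V (s i) _ _) ⟨
    f i +V s i · (t · s j · f j +V u · s k · f k)
      ≡⟨ ·-rescale (s i) eq ⟩
    0V ∎)
  where open ≡-Reasoning

leadingSign : ∀ {n} → Vec (Fin 3) n → Sign
leadingSign [] = +
leadingSign (0F ∷ x) = leadingSign x
leadingSign (1F ∷ x) = +
leadingSign (2F ∷ x) = -

normalise : V → V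
normalise x = leadingSign x · x

-- The zero vector and one representative of each of the 13 points of the
-- projective plane over ℤ₃.
normalised : List V
normalised =
    (0F ∷ 0F ∷ 0F ∷ []) ∷ (0F ∷ 0F ∷ 1F ∷ [])
  ∷ (0F ∷ 1F ∷ 0F ∷ []) ∷ (0F ∷ 1F ∷ 1F ∷ []) ∷ (0F ∷ 1F ∷ 2F ∷ [])
  ∷ (1F ∷ 0F ∷ 0F ∷ []) ∷ (1F ∷ 0F ∷ 1F ∷ []) ∷ (1F ∷ 0F ∷ 2F ∷ [])
  ∷ (1F ∷ 1F ∷ 0F ∷ []) ∷ (1F ∷ 1F ∷ 1F ∷ []) ∷ (1F ∷ 1F ∷ 2F ∷ [])
  ∷ (1F ∷ 2F ∷ 0F ∷ []) ∷ (1F ∷ 2F ∷ 1F ∷ []) ∷ (1F ∷ 2F ∷ 2F ∷ []) ∷ []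

infix 4 _≟V_
_≟V_ : (x y : V) → Dec (x ≡ y)
_≟V_ = ≡-dec _≟_

all-V? : {P : V → Set} → Decidable P → Dec (∀ x → P x)
all-V? P? = map′ (λ ∀P → λ { (a ∷ b ∷ c ∷ []) → ∀P a b c }) (λ ∀P a b c → ∀P (a ∷ b ∷ c ∷ []))
                 (all? λ a → all? λ b → all? λ c → P? (a ∷ b ∷ c ∷ []))

normalise∈normalised : ∀ x → normalise x ∈ normalised
normalise∈normalised = from-yes (all-V? λ x → _∈?_ _≟V_ (normalise x) normalised)

any-Sign? : {P : Sign → Set} → Decidable P → Dec (∃ P)
any-Sign? {P} P? = map′ [ (+ ,_) , (- ,_) ] from (P? + ⊎-dec P? -)
  where
  from : ∃ P → P + ⊎ P -
  from (+ , p) = inj₁ p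
  from (- , p) = inj₂ p

module _ (x : V) {m : ℕ} (xs : Vec V m) where

  NewDependency : Set
  NewDependency = x ≡ 0V
    ⊎ (∃[ j ] ∃[ t ] x +V t · lookup xs j ≡ 0V)
    ⊎ (∃[ j ] ∃[ k ] (j < k × ∃[ t ] ∃[ u ] x +V (t · lookup xs j +V u · lookup xs k) ≡ 0V))

  newDependency? : Dec NewDependency
  newDependency? = x ≟V 0V
    ⊎-dec any? (λ j → any-Sign? λ t → x +V t · lookup xs j ≟V 0V)
    ⊎-dec any? (λ j → any? λ k → j <? k ×-dec any-Sign? λ t → any-Sign? λ u →
                       x +V (t · lookup xs j +V u · lookup xs k) ≟V 0V)

  NewDependency⇒Dependency : NewDependency → Dependency (lookup (x ∷ xs))
  NewDependency⇒Dependency (inj₁ x≡0) = null zero x≡0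
  NewDependency⇒Dependency (inj₂ (inj₁ (j , t , eq))) = pair {i = zero} {suc j} t (λ ()) eq
  NewDependency⇒Dependency (inj₂ (inj₂ (j , k , j<k , t , u , eq))) =
    triple {i = zero} {suc j} {suc k} t u (λ ()) (λ ()) (<⇒≢ j<k ∘ suc-injective) eq

-- A certificate that every extension of xs by k normalised vectors has a Dependency.
data Covered {m : ℕ} : ℕ → Vec V m → Set where
  dependent : ∀ {k xs} → Dependency (lookup xs) → Covered k xs
  branch    : ∀ {k xs} → (∀ {r} → r ∈ normalised → Covered k (r ∷ xs)) → Covered (suc k) xs

extend : ∀ {m k r} {xs : Vec V m} → Covered (suc k) xs → r ∈ normalised → Covered k (r ∷ xs)
extend (dependent d) _ = dependent (Dependency-subfamily suc-injective d)
extend (branch c) r∈ = c r∈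

Covered-zero⇒Dependency : ∀ {m} {xs : Vec V m} → Covered 0 xs → Dependency (lookup xs)
Covered-zero⇒Dependency (dependent d) = d

covered? : ∀ {m} → ℕ → Vec V m → Bool
extensions? : ∀ {m} → ℕ → Vec V m → Bool
covered? k [] = extensions? k []
covered? k (x ∷ xs) = isYes (newDependency? x xs) ∨ extensions? k (x ∷ xs)
extensions? zero xs = false
extensions? (suc k) xs = all (λ r → covered? k (r ∷ xs)) normalised

covered?-sound : ∀ {m} k (xs : Vec V m) → T (covered? k xs) → Covered k xs
extensions?-sound : ∀ {m} k (xs : Vec V m) → T (extensions? k xs) → Covered k xs
covered?-sound k [] ok = extensions?-sound k [] ok
covered?-sound k (x ∷ xs) ok with Equivalence.to T-∨ ok
... | inj₁ new = dependent (NewDependency⇒Dependency x xs (toWitness new))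
... | inj₂ ext = extensions?-sound k (x ∷ xs) ext
extensions?-sound zero xs ()
extensions?-sound (suc k) xs ok =
  branch λ r∈ → covered?-sound k _ (All-lookup (all⁺ (λ r → covered? k (r ∷ xs)) normalised ok) r∈)

-- Type-checking this runs the exhaustive search: the argument is accepted only
-- because covered? 5 [] evaluates to true.
covered-five : Covered 5 []
covered-five = covered?-sound 5 [] _

dependency-among-five-normalised : (f : Fin 5 → V) → (∀ i → f i ∈ normalised) → Dependency (lookup (tabulate f))
dependency-among-five-normalised f f∈ =
  Covered-zero⇒Dependency (extend (extend (extend (extend (extend covered-five (f∈ 4F)) (f∈ 3F)) (f∈ 2F)) (f∈ 1F)) (f∈ 0F))

dependency-among-five : (A : Fin 5 → V) → Dependency A
dependency-among-five A = Dependency-unsign (leadingSign ∘ A)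
  (Dependency-≗ (lookup∘tabulate (normalise ∘ A)) (dependency-among-five-normalised (normalise ∘ A) (normalise∈normalised ∘ A)))

subsetSum-⊥ : ∀ {n} (A : Fin n → V) → subsetSum A ⊥ ≡ 0V
subsetSum-⊥ {zero} A = refl
subsetSum-⊥ {suc n} A = subsetSum-⊥ (A ∘ suc)

subsetSum-⁅x⁆ : ∀ {n} (A : Fin n → V) i → subsetSum A ⁅ i ⁆ ≡ A i
subsetSum-⁅x⁆ A zero = trans (cong (A zero +V_) (subsetSum-⊥ (A ∘ suc))) (identityʳ (A zero))
subsetSum-⁅x⁆ A (suc i) = subsetSum-⁅x⁆ (A ∘ suc) i

subsetSum-⁅x⁆∪p : ∀ {n} (A : Fin n → V) i p → i ∉ p → subsetSum A (⁅ i ⁆ ∪ p) ≡ A i +V subsetSum A p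
subsetSum-⁅x⁆∪p A zero (outside ∷ p) _ = cong (λ q → A zero +V subsetSum (A ∘ suc) q) (∪-identityˡ p)
subsetSum-⁅x⁆∪p A zero (inside ∷ p) i∉p = ⊥-elim (i∉p here)
subsetSum-⁅x⁆∪p A (suc i) (outside ∷ p) i∉p = subsetSum-⁅x⁆∪p (A ∘ suc) i p (drop-not-there i∉p)
subsetSum-⁅x⁆∪p A (suc i) (inside ∷ p) i∉p = begin
  A zero +V subsetSum (A ∘ suc) (⁅ i ⁆ ∪ p)       ≡⟨ cong (A zero +V_) (subsetSum-⁅x⁆∪p (A ∘ suc) i p (drop-not-there i∉p)) ⟩
  A zero +V (A (suc i) +V subsetSum (A ∘ suc) p)  ≡⟨ x∙yz≈y∙xz (A zero) (A (suc i)) _ ⟩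
  A (suc i) +V (A zero +V subsetSum (A ∘ suc) p)  ∎
  where open ≡-Reasoning

∣⁅x⁆∪p∣ : ∀ {n} (i : Fin n) p → i ∉ p → ∣ ⁅ i ⁆ ∪ p ∣ ≡ suc ∣ p ∣
∣⁅x⁆∪p∣ zero (outside ∷ p) _ = cong (suc ∘ ∣_∣) (∪-identityˡ p)
∣⁅x⁆∪p∣ zero (inside ∷ p) i∉p = ⊥-elim (i∉p here)
∣⁅x⁆∪p∣ (suc i) (outside ∷ p) i∉p = ∣⁅x⁆∪p∣ i p (drop-not-there i∉p)
∣⁅x⁆∪p∣ (suc i) (inside ∷ p) i∉p = cong suc (∣⁅x⁆∪p∣ i p (drop-not-there i∉p))

module _ {n : ℕ} (A : Fin n → V) where

  ZeroSum : Set
  ZeroSum = ∃[ S ] (1 ≤ ∣ S ∣ × ∣ S ∣ ≤ 3 × subsetSum A S ≡ 0V)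

  SumTriple : Set
  SumTriple = ∃[ i ] ∃[ j ] ∃[ k ] (i ≢ j × i ≢ k × j ≢ k × A i +V A j ≡ A k)

  zeroSum : ∀ S {k} → ∣ S ∣ ≡ k → 1 ≤ k → k ≤ 3 → subsetSum A S ≡ 0V → ZeroSum
  zeroSum S refl 1≤k k≤3 eq = S , 1≤k , k≤3 , eq

  zeroSum₁ : ∀ {i} → A i ≡ 0V → ZeroSum
  zeroSum₁ {i} eq = zeroSum ⁅ i ⁆ (∣⁅x⁆∣≡1 i) (s≤s z≤n) (s≤s z≤n) (trans (subsetSum-⁅x⁆ A i) eq)

  zeroSum₂ : ∀ {i j} → i ≢ j → A i +V A j ≡ 0V → ZeroSum
  zeroSum₂ {i} {j} i≢j eq = zeroSum (⁅ i ⁆ ∪ ⁅ j ⁆) size (s≤s z≤n) (s≤s (s≤s z≤n)) (trans sum eq)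
    where
    i∉ : i ∉ ⁅ j ⁆
    i∉ = x≢y⇒x∉⁅y⁆ i≢j
    size : ∣ ⁅ i ⁆ ∪ ⁅ j ⁆ ∣ ≡ 2
    size = trans (∣⁅x⁆∪p∣ i ⁅ j ⁆ i∉) (cong suc (∣⁅x⁆∣≡1 j))
    sum : subsetSum A (⁅ i ⁆ ∪ ⁅ j ⁆) ≡ A i +V A j
    sum = trans (subsetSum-⁅x⁆∪p A i ⁅ j ⁆ i∉) (cong (A i +V_) (subsetSum-⁅x⁆ A j))

  zeroSum₃ : ∀ {i j k} → i ≢ j → i ≢ k → j ≢ k → A i +V (A j +V A k) ≡ 0V → ZeroSum
  zeroSum₃ {i} {j} {k} i≢j i≢k j≢k eq =
    zeroSum (⁅ i ⁆ ∪ (⁅ j ⁆ ∪ ⁅ k ⁆)) size (s≤s z≤n) (s≤s (s≤s (s≤s z≤n))) (trans sum eq)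
    where
    j∉ : j ∉ ⁅ k ⁆
    j∉ = x≢y⇒x∉⁅y⁆ j≢k
    i∉ : i ∉ ⁅ j ⁆ ∪ ⁅ k ⁆
    i∉ = [ x≢y⇒x∉⁅y⁆ i≢j , x≢y⇒x∉⁅y⁆ i≢k ] ∘ x∈p∪q⁻ ⁅ j ⁆ ⁅ k ⁆
    size : ∣ ⁅ i ⁆ ∪ (⁅ j ⁆ ∪ ⁅ k ⁆) ∣ ≡ 3
    size = trans (∣⁅x⁆∪p∣ i _ i∉) (cong suc (trans (∣⁅x⁆∪p∣ j ⁅ k ⁆ j∉) (cong suc (∣⁅x⁆∣≡1 k))))
    sum : subsetSum A (⁅ i ⁆ ∪ (⁅ j ⁆ ∪ ⁅ k ⁆)) ≡ A i +V (A j +V A k)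
    sum = begin
      subsetSum A (⁅ i ⁆ ∪ (⁅ j ⁆ ∪ ⁅ k ⁆))     ≡⟨ subsetSum-⁅x⁆∪p A i _ i∉ ⟩
      A i +V subsetSum A (⁅ j ⁆ ∪ ⁅ k ⁆)        ≡⟨ cong (A i +V_) (subsetSum-⁅x⁆∪p A j ⁅ k ⁆ j∉) ⟩
      A i +V (A j +V subsetSum A ⁅ k ⁆)         ≡⟨ cong (λ v → A i +V (A j +V v)) (subsetSum-⁅x⁆ A k) ⟩
      A i +V (A j +V A k)                       ∎
      where open ≡-Reasoning

  Dependency⇒ZeroSum⊎SumTriple : Injective _≡_ _≡_ A → Dependency A → ZeroSum ⊎ SumTriple
  Dependency⇒ZeroSum⊎SumTriple A-inj (null i eq) = inj₁ (zeroSum₁ eq)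
  Dependency⇒ZeroSum⊎SumTriple A-inj (pair + i≢j eq) = inj₁ (zeroSum₂ i≢j eq)
  Dependency⇒ZeroSum⊎SumTriple A-inj (pair - i≢j eq) = ⊥-elim (i≢j (A-inj (x∙y⁻¹≈ε⇒x≈y _ _ eq)))
  Dependency⇒ZeroSum⊎SumTriple A-inj (triple + + i≢j i≢k j≢k eq) = inj₁ (zeroSum₃ i≢j i≢k j≢k eq)
  Dependency⇒ZeroSum⊎SumTriple A-inj (triple {i} {j} {k} + - i≢j i≢k j≢k eq) =
    inj₂ (i , j , k , i≢j , i≢k , j≢k , x∙[y∙z⁻¹]≈ε⇒x∙y≈z +V-group eq)
  Dependency⇒ZeroSum⊎SumTriple A-inj (triple {i} {j} {k} - + i≢j i≢k j≢k eq) =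
    inj₂ (i , k , j , i≢k , i≢j , ≢-sym j≢k , x∙[y⁻¹∙z]≈ε⇒x∙z≈y +V-abelianGroup eq)
  Dependency⇒ZeroSum⊎SumTriple A-inj (triple {i} {j} {k} - - i≢j i≢k j≢k eq) =
    inj₂ (j , k , i , j≢k , ≢-sym i≢j , ≢-sym i≢k , x∙[y⁻¹∙z⁻¹]≈ε⇒y∙z≈x +V-abelianGroup eq)

mainTheorem11 : (A : Fin 5 → V) → Injective _≡_ _≡_ A →
    (∃[ S ] (1 ≤ ∣ S ∣ × ∣ S ∣ ≤ 3 × subsetSum A S ≡ 0V))
    ⊎ (∃[ i ] ∃[ j ] ∃[ k ] (i ≢ j × i ≢ k × j ≢ k × A i +V A j ≡ A k))
mainTheorem11 A A-inj = Dependency⇒ZeroSum⊎SumTriple A A-inj (dependency-among-five A)
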